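{- The Conditional-Strengthen rule preserves validity of annotated sequents. Precisely: let $A,B$ be conjunctions of $\mathcal{LA}(\mathbb{Z})$ equalities and inequalities and suppose $(A,B)\vdash(\sum_i c_ix_i+c\le 0)\,[\{\langle t'\le 0,\top\rangle\}]$ is a valid annotated sequent. Let $d>0$ be an integer dividing all the $c_i$, let $k=d\lceil c/d\rceil-c$, and let $P$ be the inequality $(\sum_i c_ix_i+c-t'\le 0)$, so that $\neg P$ is (over the integers) the inequality $(-\sum_ic_ix_i-c+t'+1\le 0)$. Assume that every variable of $\sum_i c_ix_i+c+k$ and every variable of $P$ occurs in both $A$ and $B$. Then $(A,B)\vdash(\sum_i c_ix_i+c+k\le 0)\,[I]$ with $I=\{\langle \neg P,\neg P\rangle,\ \langle \sum_ic_ix_i+c+k\le 0,\top\rangle\}$ is a valid annotated sequent (where in the first pair the second component is the inequality $\neg P$ rather than a conjunction of (modular) equalities).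
   Context: $\mathcal{LA}(\mathbb{Z})$: variables range over $\mathbb{Z}$, terms are integer linear combinations of variables plus an integer constant, $\models$ is entailment over integer assignments. $\phi\preceq\psi$ means every variable of $\phi$ occurs in $\psi$. An annotated sequent $(A,B)\vdash(t\le0)[I]$ consists of conjunctions $A,B$ of equalities/inequalities, a linear term $t$, and a set $I$ of pairs $\langle t_i\le0,E_i\rangle$ where $t_i$ is a linear term and $E_i$ is a (possibly empty, i.e. $\top$) conjunction of $\mathcal{LA}(\mathbb{Z})$ constraints (equalities, modular equalities, or — as allowed here — inequalities). It is valid when: (1) $A\models\bigvee_{\langle t_i\le0,E_i\rangle\in I}((t_i\le0)\wedge E_i)$; (2) for all pairs, $B\wedge E_i\models(t-t_i\le0)$; (3) for all pairs, $t_i\preceq A$, $(t-t_i)\preceq B$, $E_i\preceq A$, $E_i\preceq B$. A pair whose first component is $\neg P$ is read with $\neg P$ written as the inequality $(-\sum_ic_ix_i-c+t'+1\le 0)$. -}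

module Defs where

open import Data.Nat using (ℕ; zero; suc)
open import Data.Integer as ℤ using (ℤ; +_; 0ℤ; 1ℤ; _+_; _-_; _*_; -_; _≤_; _<_; _/_; >-nonZero)
open import Data.Integer.Divisibility using (_∣_)
open import Data.Fin using (Fin; zero; suc)
open import Data.List using (List; []; _∷_)
open import Data.List.Relation.Unary.All using (All)
open import Data.List.Relation.Unary.Any using (Any)
open import Data.Product using (_×_; _,_; proj₁; proj₂)
open import Relation.Binary.PropositionalEquality using (_≡_)
open import Relation.Nullary using (¬_)

record Term (n : ℕ) : Set where
  constructor term
  field
    coeff : Fin n → ℤ
    const : ℤ
open Term public

Assignment : ℕ → Set
Assignment n = Fin n → ℤ

sumFin : ∀ {n} → (Fin n → ℤ) → ℤ
sumFin {zero}  f = 0ℤ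
sumFin {suc n} f = f zero + sumFin (λ i → f (suc i))

⟦_⟧ : ∀ {n} → Term n → Assignment n → ℤ
⟦ t ⟧ ρ = sumFin (λ i → coeff t i * ρ i) + const t

_⊕_ : ∀ {n} → Term n → Term n → Term n
s ⊕ t = term (λ i → coeff s i + coeff t i) (const s + const t)

⊝_ : ∀ {n} → Term n → Term n
⊝ t = term (λ i → - coeff t i) (- const t)

_⊖_ : ∀ {n} → Term n → Term n → Term n
s ⊖ t = s ⊕ (⊝ t)

_+ᶜ_ : ∀ {n} → Term n → ℤ → Term n
t +ᶜ k = term (coeff t) (const t + k)

data Constraint (n : ℕ) : Set where
  eqC  : Term n → Constraint n
  leC  : Term n → Constraint n
  modC : ℤ → Term n → Constraint n

Sat : ∀ {n} → Assignment n → Constraint n → Set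
Sat ρ (eqC t)    = ⟦ t ⟧ ρ ≡ 0ℤ
Sat ρ (leC t)    = ⟦ t ⟧ ρ ≤ 0ℤ
Sat ρ (modC m t) = m ∣ ⟦ t ⟧ ρ

Conj : ℕ → Set
Conj n = List (Constraint n)

SatConj : ∀ {n} → Assignment n → Conj n → Set
SatConj ρ E = All (Sat ρ) E

data IsEqIneq {n : ℕ} : Constraint n → Set where
  isEq : ∀ t → IsEqIneq (eqC t)
  isLe : ∀ t → IsEqIneq (leC t)

EqIneqConj : ∀ {n} → Conj n → Set
EqIneqConj A = All IsEqIneq A

OccT : ∀ {n} → Fin n → Term n → Set
OccT x t = ¬ (coeff t x ≡ 0ℤ)

OccC : ∀ {n} → Fin n → Constraint n → Set
OccC x (eqC t)    = OccT x t
OccC x (leC t)    = OccT x t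
OccC x (modC m t) = OccT x t

OccConj : ∀ {n} → Fin n → Conj n → Set
OccConj x A = Any (OccC x) A

_⪯ᵗ_ : ∀ {n} → Term n → Conj n → Set
t ⪯ᵗ A = ∀ x → OccT x t → OccConj x A

_⪯ᶜ_ : ∀ {n} → Conj n → Conj n → Set
E ⪯ᶜ A = ∀ x → OccConj x E → OccConj x A

_⊨_ : ∀ {n} → Conj n → (Assignment n → Set) → Set
A ⊨ φ = ∀ ρ → SatConj ρ A → φ ρ

-- annotation set I : list of pairs ⟨ t_i ≤ 0 , E_i ⟩
Annot : ℕ → Set
Annot n = List (Term n × Conj n)

record ValidSeq {n : ℕ} (A B : Conj n) (t : Term n) (I : Annot n) : Set where
  field
    cond1 : A ⊨ (λ ρ → Any (λ p → ⟦ proj₁ p ⟧ ρ ≤ 0ℤ × SatConj ρ (proj₂ p)) I)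
    cond2 : All (λ p → (B Data.List.++ proj₂ p) ⊨ (λ ρ → ⟦ t ⊖ proj₁ p ⟧ ρ ≤ 0ℤ)) I
    cond3 : All (λ p → (proj₁ p ⪯ᵗ A) × ((t ⊖ proj₁ p) ⪯ᵗ B)
                       × (proj₂ p ⪯ᶜ A) × (proj₂ p ⪯ᶜ B)) I

-- ⌈ c / d ⌉ for d > 0  (library _/_ is floor division for positive divisors)
ceilDiv : (c d : ℤ) → 0ℤ < d → ℤ
ceilDiv c d d>0 = - ((- c) / d) where instance _ = >-nonZero d>0

-- Since d divides every cᵢ, the value of Σ cᵢxᵢ is a multiple of d, so from
-- Σ cᵢxᵢ ≤ -c one gets Σ cᵢxᵢ ≤ d ⌊-c/d⌋ = -d ⌈c/d⌉, i.e. Σ cᵢxᵢ + c + k ≤ 0.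
-- Every model of A either satisfies ¬P, or satisfies P and then t ≤ t' ≤ 0,
-- hence the strengthened inequality.  On the B side ¬P is inconsistent with
-- the interpolant bound t ≤ t' that B already entails.
module Submission where

open import Defs
open import Data.Nat using (ℕ)
open import Data.Integer
  using (ℤ; +_; 0ℤ; 1ℤ; _+_; _-_; -_; _*_; _/_; _%_; _≤_; _<_; _≤?_; pred; +<+;
         NonZero; NonNegative; >-nonZero; nonNegative)
  renaming (suc to sucℤ)
open import Data.Integer.Properties
open import Algebra.Properties.CommutativeSemigroup +-commutativeSemigroup
  using () renaming (interchange to +-interchange)
open import Data.Integer.DivMod using (a≡a%n+[a/n]*n; n%d<d)
open import Data.Integer.Divisibility using (_∣_)
open import Data.Integer.Divisibility.Signed as Signed using (divides; ∣ᵤ⇒∣; ∣m∣n⇒∣m+n; ∣m⇒∣m*n)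
open import Data.Integer.Tactic.RingSolver using (solve-∀)
open import Data.Fin using (Fin; zero; suc)
open import Data.List using ([]; _∷_)
open import Data.List.Relation.Unary.All using ([]; _∷_; head)
open import Data.List.Relation.Unary.All.Properties using (++⁺; ++⁻ˡ; ++⁻ʳ)
open import Data.List.Relation.Unary.Any using (Any; here; there)
open import Data.List.Relation.Unary.Any.Properties using (singleton⁻)
open import Data.Product using (_×_; _,_; proj₁; proj₂)
open import Data.Sum using (_⊎_; inj₁; inj₂)
open import Relation.Nullary using (¬_; yes; no; contradiction)
open import Relation.Binary.PropositionalEquality
  using (_≡_; refl; sym; trans; cong; cong₂; subst; module ≡-Reasoning)

private variable
  n : ℕ
  x : Fin n
  u v : Term n
  ρ : Assignment n
  A B C : Conj n

sumFin-cong : {f g : Fin n → ℤ} → (∀ i → f i ≡ g i) → sumFin f ≡ sumFin g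
sumFin-cong {n = ℕ.zero}  f≗g = refl
sumFin-cong {n = ℕ.suc n} f≗g = cong₂ _+_ (f≗g zero) (sumFin-cong (λ i → f≗g (suc i)))

sumFin-+ : (f g : Fin n → ℤ) → sumFin (λ i → f i + g i) ≡ sumFin f + sumFin g
sumFin-+ {n = ℕ.zero}  f g = refl
sumFin-+ {n = ℕ.suc n} f g =
  trans (cong (_+_ (f zero + g zero)) (sumFin-+ (λ i → f (suc i)) (λ i → g (suc i))))
        (+-interchange (f zero) (g zero) _ _)

sumFin-neg : (f : Fin n → ℤ) → sumFin (λ i → - f i) ≡ - sumFin f
sumFin-neg {n = ℕ.zero}  f = refl
sumFin-neg {n = ℕ.suc n} f =
  trans (cong (_+_ (- f zero)) (sumFin-neg (λ i → f (suc i))))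
        (sym (neg-distrib-+ (f zero) _))

∣-sumFin : ∀ {d} {f : Fin n → ℤ} → (∀ i → d Signed.∣ f i) → d Signed.∣ sumFin f
∣-sumFin {n = ℕ.zero}  d∣f = divides 0ℤ refl
∣-sumFin {n = ℕ.suc n} d∣f = ∣m∣n⇒∣m+n (d∣f zero) (∣-sumFin (λ i → d∣f (suc i)))

linear : Term n → Assignment n → ℤ
linear t ρ = sumFin (λ i → coeff t i * ρ i)

⟦⊕⟧ : ∀ (s t : Term n) ρ → ⟦ s ⊕ t ⟧ ρ ≡ ⟦ s ⟧ ρ + ⟦ t ⟧ ρ
⟦⊕⟧ s t ρ = begin
  sumFin (λ i → (coeff s i + coeff t i) * ρ i) + (const s + const t)
    ≡⟨ cong (_+ (const s + const t)) (sumFin-cong (λ i → *-distribʳ-+ (ρ i) (coeff s i) (coeff t i))) ⟩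
  sumFin (λ i → coeff s i * ρ i + coeff t i * ρ i) + (const s + const t)
    ≡⟨ cong (_+ (const s + const t)) (sumFin-+ (λ i → coeff s i * ρ i) (λ i → coeff t i * ρ i)) ⟩
  (linear s ρ + linear t ρ) + (const s + const t)
    ≡⟨ +-interchange (linear s ρ) (linear t ρ) (const s) (const t) ⟩
  ⟦ s ⟧ ρ + ⟦ t ⟧ ρ ∎
  where open ≡-Reasoning

⟦⊝⟧ : ∀ (t : Term n) ρ → ⟦ ⊝ t ⟧ ρ ≡ - ⟦ t ⟧ ρ
⟦⊝⟧ t ρ = begin
  sumFin (λ i → - coeff t i * ρ i) + - const t
    ≡⟨ cong (_+ - const t) (sumFin-cong (λ i → sym (neg-distribˡ-* (coeff t i) (ρ i)))) ⟩
  sumFin (λ i → - (coeff t i * ρ i)) + - const t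
    ≡⟨ cong (_+ - const t) (sumFin-neg (λ i → coeff t i * ρ i)) ⟩
  - linear t ρ + - const t
    ≡⟨ neg-distrib-+ (linear t ρ) (const t) ⟨
  - ⟦ t ⟧ ρ ∎
  where open ≡-Reasoning

⟦⊖⟧ : ∀ (s t : Term n) ρ → ⟦ s ⊖ t ⟧ ρ ≡ ⟦ s ⟧ ρ - ⟦ t ⟧ ρ
⟦⊖⟧ s t ρ = trans (⟦⊕⟧ s (⊝ t) ρ) (cong (_+_ (⟦ s ⟧ ρ)) (⟦⊝⟧ t ρ))

⟦⊖-self⟧ : ∀ (t : Term n) ρ → ⟦ t ⊖ t ⟧ ρ ≡ 0ℤ
⟦⊖-self⟧ t ρ = trans (⟦⊖⟧ t t ρ) (+-inverseʳ (⟦ t ⟧ ρ))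

-- Over ℤ, ¬ (u ≤ v) is the inequality v - u + 1 ≤ 0.
negLe : Term n → Term n → Term n
negLe u v = ((⊝ u) ⊕ v) +ᶜ 1ℤ

⟦negLe⟧ : ∀ (u v : Term n) ρ → ⟦ negLe u v ⟧ ρ ≡ sucℤ (⟦ v ⟧ ρ - ⟦ u ⟧ ρ)
⟦negLe⟧ u v ρ = begin
  linear ((⊝ u) ⊕ v) ρ + (const ((⊝ u) ⊕ v) + 1ℤ)
    ≡⟨ +-assoc (linear ((⊝ u) ⊕ v) ρ) _ 1ℤ ⟨
  ⟦ (⊝ u) ⊕ v ⟧ ρ + 1ℤ
    ≡⟨ cong (_+ 1ℤ) (trans (⟦⊕⟧ (⊝ u) v ρ) (cong (_+ ⟦ v ⟧ ρ) (⟦⊝⟧ u ρ))) ⟩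
  (- ⟦ u ⟧ ρ + ⟦ v ⟧ ρ) + 1ℤ
    ≡⟨ rearrange (⟦ u ⟧ ρ) (⟦ v ⟧ ρ) ⟩
  sucℤ (⟦ v ⟧ ρ - ⟦ u ⟧ ρ) ∎
  where
  open ≡-Reasoning
  rearrange : ∀ a b → (- a + b) + 1ℤ ≡ 1ℤ + (b - a)
  rearrange = solve-∀

negLe-sound : ⟦ negLe u v ⟧ ρ ≤ 0ℤ → ¬ (⟦ u ⟧ ρ ≤ ⟦ v ⟧ ρ)
negLe-sound {u = u} {v} {ρ} ¬u≤v u≤v =
  <⇒≱ (suc[i]≤j⇒i<j (suc-mono (i≤j⇒0≤j-i u≤v)))
      (subst (_≤ 0ℤ) (⟦negLe⟧ u v ρ) ¬u≤v)

negLe-complete : ¬ (⟦ negLe u v ⟧ ρ ≤ 0ℤ) → ⟦ u ⟧ ρ ≤ ⟦ v ⟧ ρ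
negLe-complete {u = u} {v} {ρ} ¬[¬u≤v] =
  0≤i-j⇒j≤i (subst (0ℤ ≤_) (pred-suc _) (i<j⇒i≤pred[j] 0<suc[v-u]))
  where
  0<suc[v-u] : 0ℤ < sucℤ (⟦ v ⟧ ρ - ⟦ u ⟧ ρ)
  0<suc[v-u] = ≰⇒> (λ le → ¬[¬u≤v] (subst (_≤ 0ℤ) (sym (⟦negLe⟧ u v ρ)) le))

module _ {d : ℤ} (d>0 : 0ℤ < d) where

  private instance
    d≢0 : NonZero d
    d≢0 = >-nonZero d>0
    d≥0 : NonNegative d
    d≥0 = nonNegative (<⇒≤ d>0)

  a<suc[a/d]*d : ∀ a → a < sucℤ (a / d) * d
  a<suc[a/d]*d a = begin-strict
    a                     ≡⟨ a≡a%n+[a/n]*n a d ⟩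
    + (a % d) + a / d * d <⟨ +-monoˡ-< (a / d * d) a%d<d ⟩
    d + a / d * d         ≡⟨ suc-* (a / d) d ⟨
    sucℤ (a / d) * d      ∎
    where
    open ≤-Reasoning
    a%d<d : + (a % d) < d
    a%d<d = subst (+ (a % d) <_) (0≤i⇒+∣i∣≡i (<⇒≤ d>0)) (+<+ (n%d<d a d))

  q*d≤a⇒q≤a/d : ∀ q a → q * d ≤ a → q ≤ a / d
  q*d≤a⇒q≤a/d q a q*d≤a = subst (q ≤_) (pred-suc (a / d))
    (i<j⇒i≤pred[j] (*-cancelʳ-<-nonNeg {i = q} {j = sucℤ (a / d)} d (≤-<-trans q*d≤a (a<suc[a/d]*d a))))

  strengthen-ceilDiv : ∀ {cs c} → (∀ i → d ∣ cs i) →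
            ⟦ term cs c ⟧ ρ ≤ 0ℤ → ⟦ term cs c +ᶜ (d * ceilDiv c d d>0 - c) ⟧ ρ ≤ 0ℤ
  strengthen-ceilDiv {ρ = ρ} {cs} {c} d∣cs t≤0 with ∣-sumFin (λ i → ∣m⇒∣m*n {m = cs i} (ρ i) (∣ᵤ⇒∣ (d∣cs i)))
  ... | divides q X≡q*d = begin
    linear (term cs c) ρ + (c + (d * ceilDiv c d d>0 - c)) ≡⟨ cong (_+ _) X≡q*d ⟩
    q * d + (c + (d * - (- c / d) - c))                    ≡⟨ cancel q d c (- c / d) ⟩
    q * d - - c / d * d                                    ≤⟨ i≤j⇒i-j≤0 (*-monoʳ-≤-nonNeg d q≤-c/d) ⟩
    0ℤ                                                     ∎
    where
    open ≤-Reasoning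
    q≤-c/d : q ≤ - c / d
    q≤-c/d = q*d≤a⇒q≤a/d q (- c)
      (i-j≤0⇒i≤j (subst (_≤ 0ℤ) (cong₂ _+_ X≡q*d (sym (neg-involutive c))) t≤0))
    cancel : ∀ q d c f → q * d + (c + (d * - f - c)) ≡ q * d - f * d
    cancel = solve-∀

occ-⊕ : OccT x (u ⊕ v) → OccT x u ⊎ OccT x v
occ-⊕ {x = x} {u} {v} occ with coeff u x ≟ 0ℤ
... | yes u≡0 = inj₂ (λ v≡0 → occ (cong₂ _+_ u≡0 v≡0))
... | no  u≢0 = inj₁ u≢0

occ-⊝ : OccT x (⊝ u) → OccT x u
occ-⊝ occ u≡0 = occ (cong -_ u≡0)

occ-negLe : OccT x (negLe u v) → OccT x (u ⊖ v)
occ-negLe {x = x} {u} {v} occ u-v≡0 =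
  occ (trans (-a+b≡-[a-b] (coeff u x) (coeff v x)) (cong -_ u-v≡0))
  where
  -a+b≡-[a-b] : ∀ a b → - a + b ≡ - (a - b)
  -a+b≡-[a-b] = solve-∀

⊖-self-⪯ᵗ : (u ⊖ u) ⪯ᵗ C
⊖-self-⪯ᵗ {u = u} x occ = contradiction (+-inverseʳ (coeff u x)) occ

leC-⪯ᶜ : u ⪯ᵗ C → (leC u ∷ []) ⪯ᶜ C
leC-⪯ᶜ u⪯C x (here occ) = u⪯C x occ

Covered : Assignment n → Annot n → Set
Covered ρ I = Any (λ p → ⟦ proj₁ p ⟧ ρ ≤ 0ℤ × SatConj ρ (proj₂ p)) I

unconditional-cover : ∀ {t t'} → ValidSeq A B t ((t' , []) ∷ []) → A ⊨ (λ ρ → ⟦ t' ⟧ ρ ≤ 0ℤ)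
unconditional-cover V ρ ⊨A = proj₁ (singleton⁻ (ValidSeq.cond1 V ρ ⊨A))

unconditional-bound : ∀ {t t'} → ValidSeq A B t ((t' , []) ∷ []) → B ⊨ (λ ρ → ⟦ t ⟧ ρ ≤ ⟦ t' ⟧ ρ)
unconditional-bound {t = t} {t'} V ρ ⊨B =
  i-j≤0⇒i≤j (subst (_≤ 0ℤ) (⟦⊖⟧ t t' ρ) (head (ValidSeq.cond2 V) ρ (++⁺ ⊨B [])))

theorem3p8 : ∀ {n : ℕ} (A B : Conj n) (cs : Fin n → ℤ) (c : ℤ) (t' : Term n)
    → EqIneqConj A → EqIneqConj B
    → ValidSeq A B (term cs c) ((t' , []) ∷ [])
    → (d : ℤ) (d>0 : 0ℤ < d) → (∀ i → d ∣ cs i)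
    → let k = d * ceilDiv c d d>0 - c
          P = term cs c ⊖ t'
          notP = ((⊝ (term cs c)) ⊕ t') +ᶜ 1ℤ
      in ((term cs c +ᶜ k) ⪯ᵗ A) → ((term cs c +ᶜ k) ⪯ᵗ B)
       → (P ⪯ᵗ A) → (P ⪯ᵗ B)
       → ValidSeq A B (term cs c +ᶜ k)
           ((notP , leC notP ∷ []) ∷ ((term cs c +ᶜ k) , []) ∷ [])
theorem3p8 A B cs c t' _ _ V d d>0 d∣cs s⪯A s⪯B P⪯A P⪯B = record
  { cond1 = cover
  ; cond2 = (λ ρ ⊨B¬P → contradiction (unconditional-bound V ρ (++⁻ˡ B ⊨B¬P))
                                      (negLe-sound {u = t} {t'} (head (++⁻ʳ B ⊨B¬P))))
          ∷ (λ ρ _ → ≤-reflexive (⟦⊖-self⟧ s ρ)) ∷ []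
  ; cond3 = (¬P⪯ P⪯A , s⊖¬P⪯B , leC-⪯ᶜ (¬P⪯ P⪯A) , leC-⪯ᶜ (¬P⪯ P⪯B))
          ∷ (s⪯A , ⊖-self-⪯ᵗ {u = s} , (λ _ ()) , (λ _ ())) ∷ []
  }
  where
  t s ¬P : Term _
  t = term cs c
  s = t +ᶜ (d * ceilDiv c d d>0 - c)
  ¬P = negLe t t'

  cover : ∀ ρ → SatConj ρ A → Covered ρ ((¬P , leC ¬P ∷ []) ∷ (s , []) ∷ [])
  cover ρ ⊨A with ⟦ ¬P ⟧ ρ ≤? 0ℤ
  ... | yes ¬P≤0 = here (¬P≤0 , ¬P≤0 ∷ [])
  ... | no  ¬P≰0 = there (here (strengthen-ceilDiv d>0 {ρ = ρ} {cs = cs} {c = c} d∣cs t≤0 , []))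
    where
    t≤0 : ⟦ t ⟧ ρ ≤ 0ℤ
    t≤0 = ≤-trans (negLe-complete {u = t} {t'} ¬P≰0) (unconditional-cover V ρ ⊨A)

  ¬P⪯ : ∀ {C} → (t ⊖ t') ⪯ᵗ C → ¬P ⪯ᵗ C
  ¬P⪯ P⪯C x occ = P⪯C x (occ-negLe {u = t} {t'} occ)

  s⊖¬P⪯B : (s ⊖ ¬P) ⪯ᵗ B
  s⊖¬P⪯B x occ with occ-⊕ {u = s} {v = ⊝ ¬P} occ
  ... | inj₁ s-occ  = s⪯B x s-occ
  ... | inj₂ ¬P-occ = ¬P⪯ P⪯B x (occ-⊝ {u = ¬P} ¬P-occ)
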